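{- Let $\mathcal R$ be a collection of tournaments on a set $V$ such that any two distinct ordered pairs $(x,y),(x',y')\in V\times V\setminus\Delta_V$ are separated by some member of $\mathcal R$. For a non-empty subset $X$ of $\mathcal R$ the following are equivalent: (i) any two distinct ordered pairs $(x,y),(x',y')\in V\times V\setminus\Delta_V$ are separated by some member of $X$; (ii) $X\cup X^{ -1}$ is $2$-dense in $\mathcal R$.
   Context: $\Delta_V:=\{(x,x):x\in V\}$. A tournament on $V$ is an irreflexive binary relation $\tau$ on $V$ such that for distinct $x,y$ exactly one of $(x,y),(y,x)$ lies in $\tau$; $\tau(x,y)=1$ if $(x,y)\in\tau$ and $0$ otherwise; $\tau$ separates $(x,y),(x',y')$ if $\tau(x,y)\neq\tau(x',y')$. $X^{ -1}:=\{\rho^{ -1}:\rho\in X\}$, where $\rho^{ -1}:=\{(y,x):(x,y)\in\rho\}$. A subset $D$ of $\mathcal R$ is $2$-dense in $\mathcal R$ if for every $\rho\in\mathcal R$ and every $2$-element subset $U$ of $V\times V\setminus\Delta_V$ there is $\tau\in D$ with $\tau(u)=\rho(u)$ for all $u\in U$. (Here $D=X\cup X^{ -1}$ need not be contained in $\mathcal R$.) -}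

module Defs where

open import Data.Bool using (Bool; true; false; not)
open import Data.Product using (Σ; _×_; ∃)
open import Data.Sum using (_⊎_)
open import Relation.Binary.PropositionalEquality using (_≡_; _≢_)
open import Relation.Nullary using (¬_)

-- A binary relation on V, given by its characteristic function:
-- ρ x y ≡ true  iff  (x , y) ∈ ρ   (this is the paper's ρ(x,y) ∈ {0,1}).
BRel : Set → Set
BRel V = V → V → Bool

Coll : Set → Set₁
Coll V = BRel V → Set

module _ {V : Set} where

  record IsTournament (τ : BRel V) : Set where
    field
      irrefl : ∀ x → τ x x ≡ false
      exactlyOne : ∀ x y → x ≢ y → τ x y ≡ not (τ y x)

  SeparatesPairs : BRel V → V → V → V → V → Set
  SeparatesPairs τ x y x' y' = τ x y ≢ τ x' y'

  DistinctOffDiag : V → V → V → V → Set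
  DistinctOffDiag x y x' y' = x ≢ y × x' ≢ y' × ¬ (x ≡ x' × y ≡ y')

  Separating : Coll V → Set
  Separating C = ∀ x y x' y' → DistinctOffDiag x y x' y' →
                 Σ (BRel V) λ τ → C τ × SeparatesPairs τ x y x' y'

  inverse : BRel V → BRel V
  inverse ρ x y = ρ y x

  InvColl : Coll V → Coll V
  InvColl X ρ = Σ (BRel V) λ σ → X σ × (∀ x y → ρ x y ≡ inverse σ x y)

  _∪C_ : Coll V → Coll V → Coll V
  (X ∪C Y) ρ = X ρ ⊎ Y ρ

  _⊆C_ : Coll V → Coll V → Set
  X ⊆C Y = ∀ ρ → X ρ → Y ρ

  TwoDense : Coll V → Coll V → Set
  TwoDense D R = ∀ ρ → R ρ → ∀ x y x' y' → DistinctOffDiag x y x' y' →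
                 Σ (BRel V) λ τ → D τ × (τ x y ≡ ρ x y) × (τ x' y' ≡ ρ x' y')

-- A tournament σ and its inverse σ⁻¹ = not ∘ σ (off the diagonal) separate exactly the same
-- pairs, and on a pair {(x,y), (x',y')} the only information σ carries up to inversion is
-- whether it separates the two pairs.  Hence a member of X agrees with ρ on U up to inversion
-- as soon as it separates the pairs of U exactly when ρ does.  If ρ separates them, any
-- separating member of X will do; if not, then ρ separates (x,y) from the reversed pair
-- (y',x'), and a member of X separating those fails to separate (x,y) from (x',y').
-- Conversely, a member of X ∪ X⁻¹ agreeing with a separating ρ ∈ R on U separates U, and so
-- then does its preimage in X.
module Submission where

open import Defs
open import Data.Bool using (true; false; not; _xor_)
open import Data.Bool.Properties using (_≟_; not-¬; ¬-not; not-injective; not-involutive; xor-same)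
open import Data.Product using (Σ; _×_; ∃; _,_)
open import Data.Sum using (_⊎_; inj₁; inj₂)
open import Function.Bundles using (_⇔_; mk⇔; Equivalence)
open import Relation.Binary.PropositionalEquality
open import Relation.Nullary using (¬_; contradiction; yes; no)

xor-≡ : ∀ {a b} → a ≡ b → a xor b ≡ false
xor-≡ {a} refl = xor-same a

xor-≢ : ∀ {a b} → a ≢ b → a xor b ≡ true
xor-≢ {false} {false} a≢b = contradiction refl a≢b
xor-≢ {false} {true}  _   = refl
xor-≢ {true}  {false} _   = refl
xor-≢ {true}  {true}  a≢b = contradiction refl a≢b

xor-≡⇒≡⊎not≡ : ∀ a b c d → a xor b ≡ c xor d →
               (a ≡ c × b ≡ d) ⊎ (not a ≡ c × not b ≡ d)
xor-≡⇒≡⊎not≡ false b false d e = inj₁ (refl , e)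
xor-≡⇒≡⊎not≡ true  b true  d e = inj₁ (refl , not-injective e)
xor-≡⇒≡⊎not≡ false b true  d e = inj₂ (refl , trans (cong not e) (not-involutive d))
xor-≡⇒≡⊎not≡ true  b false d e = inj₂ (refl , e)

module _ {V : Set} where

  separated⇒distinct : ∀ {τ : BRel V} {x y x' y'} →
                       SeparatesPairs τ x y x' y' → ¬ (x ≡ x' × y ≡ y')
  separated⇒distinct τxy≢τx'y' (refl , refl) = τxy≢τx'y' refl

  module _ {τ : BRel V} (τ-tour : IsTournament τ) where
    open IsTournament τ-tour

    inverse≡not : ∀ {x y} → x ≢ y → inverse τ x y ≡ not (τ x y)
    inverse≡not x≢y = exactlyOne _ _ (≢-sym x≢y)

    separates-swap⇔≡ : ∀ {x y x' y'} → x' ≢ y' →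
                       SeparatesPairs τ x y y' x' ⇔ τ x y ≡ τ x' y'
    separates-swap⇔≡ {x} {y} {x'} {y'} x'≢y' = mk⇔ to from
      where
      to : SeparatesPairs τ x y y' x' → τ x y ≡ τ x' y'
      to sep = trans (¬-not sep) (sym (exactlyOne x' y' x'≢y'))
      from : τ x y ≡ τ x' y' → SeparatesPairs τ x y y' x'
      from eq τxy≡τy'x' = not-¬ eq (trans τxy≡τy'x' (inverse≡not x'≢y'))

    separates-inverse⇒separates : ∀ {x y x' y'} → x ≢ y → x' ≢ y' →
                                  SeparatesPairs (inverse τ) x y x' y' →
                                  SeparatesPairs τ x y x' y'
    separates-inverse⇒separates x≢y x'≢y' sep τxy≡τx'y' =
      sep (trans (inverse≡not x≢y) (trans (cong not τxy≡τx'y') (sym (inverse≡not x'≢y'))))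

  twoDense⇒separating : ∀ {D R : Coll V} → TwoDense D R → Separating R → Separating D
  twoDense⇒separating dense sepR x y x' y' dist with sepR x y x' y' dist
  ... | ρ , Rρ , ρ-sep with dense ρ Rρ x y x' y' dist
  ...   | τ , Dτ , τxy≡ρxy , τx'y'≡ρx'y' =
          τ , Dτ , λ τxy≡τx'y' → ρ-sep (trans (sym τxy≡ρxy) (trans τxy≡τx'y' τx'y'≡ρx'y'))

  module _ {X : Coll V} (X-tour : ∀ σ → X σ → IsTournament σ) where

    separating-∪-inverse⇒separating : Separating (X ∪C InvColl X) → Separating X
    separating-∪-inverse⇒separating sep x y x' y' dist@(x≢y , x'≢y' , _)
      with sep x y x' y' dist
    ... | τ , inj₁ Xτ , τ-sep = τ , Xτ , τ-sep
    ... | τ , inj₂ (σ , Xσ , τ≗σ⁻¹) , τ-sep =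
          σ , Xσ , separates-inverse⇒separates (X-tour σ Xσ) x≢y x'≢y'
                     (λ eq → τ-sep (trans (τ≗σ⁻¹ x y) (trans eq (sym (τ≗σ⁻¹ x' y')))))

    -- Whether σ separates the two pairs is recorded by σ x y xor σ x' y'.
    agree-up-to-inverse : ∀ {σ ρ : BRel V} {x y x' y'} → X σ → x ≢ y → x' ≢ y' →
                          σ x y xor σ x' y' ≡ ρ x y xor ρ x' y' →
                          Σ (BRel V) λ τ → (X ∪C InvColl X) τ ×
                                           (τ x y ≡ ρ x y) × (τ x' y' ≡ ρ x' y')
    agree-up-to-inverse {σ} {ρ} {x} {y} {x'} {y'} Xσ x≢y x'≢y' same
      with xor-≡⇒≡⊎not≡ (σ x y) (σ x' y') (ρ x y) (ρ x' y') same
    ... | inj₁ (agree , agree') = σ , inj₁ Xσ , agree , agree'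
    ... | inj₂ (agree , agree') =
          inverse σ , inj₂ (σ , Xσ , λ _ _ → refl) ,
          trans (inverse≡not σ-tour x≢y) agree , trans (inverse≡not σ-tour x'≢y') agree'
      where σ-tour = X-tour σ Xσ

    separating⇒same-pattern : ∀ {ρ : BRel V} → IsTournament ρ → Separating X →
                         ∀ {x y x' y'} → DistinctOffDiag x y x' y' →
                         ∃ λ σ → X σ × (σ x y xor σ x' y' ≡ ρ x y xor ρ x' y')
    separating⇒same-pattern {ρ} ρ-tour sepX {x} {y} {x'} {y'} dist@(x≢y , x'≢y' , _)
      with ρ x y ≟ ρ x' y'
    ... | no ρ-sep =
          let σ , Xσ , σ-sep = sepX x y x' y' dist
          in σ , Xσ , trans (xor-≢ σ-sep) (sym (xor-≢ ρ-sep))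
    ... | yes ρ-same =
          let ρ-sep-swap = Equivalence.from (separates-swap⇔≡ ρ-tour x'≢y') ρ-same
              σ , Xσ , σ-sep-swap = sepX x y y' x'
                (x≢y , ≢-sym x'≢y' , separated⇒distinct ρ-sep-swap)
              σ-same = Equivalence.to (separates-swap⇔≡ (X-tour σ Xσ) x'≢y') σ-sep-swap
          in σ , Xσ , trans (xor-≡ σ-same) (sym (xor-≡ ρ-same))

    separating⇒twoDense : ∀ {R : Coll V} → (∀ ρ → R ρ → IsTournament ρ) →
                          Separating X → TwoDense (X ∪C InvColl X) R
    separating⇒twoDense R-tour sepX ρ Rρ x y x' y' dist@(x≢y , x'≢y' , _) =
      let σ , Xσ , same = separating⇒same-pattern (R-tour ρ Rρ) sepX dist
      in agree-up-to-inverse Xσ x≢y x'≢y' same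

lemma6 : {V : Set} (R : Coll V) →
         (∀ τ → R τ → IsTournament τ) →
         Separating R →
         (X : Coll V) → X ⊆C R → Σ (BRel V) X →
         (Separating X ⇔ TwoDense (X ∪C InvColl X) R)
lemma6 R R-tour sepR X X⊆R _ =
  mk⇔ (separating⇒twoDense X-tour R-tour)
      (λ dense → separating-∪-inverse⇒separating X-tour (twoDense⇒separating dense sepR))
  where
  X-tour : ∀ σ → X σ → IsTournament σ
  X-tour σ Xσ = R-tour σ (X⊆R σ Xσ)
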